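{- For every $k\in\mathbb{N}$, $\mathrm{DN}(\mathrm{FO}_k),\mathrm{LS}(\mathrm{FO}_k),\mathrm{H}(\mathrm{FO}_k)\le\mathrm{twr}(k+\log^*(k^2+k)+1)$ and $\mathrm{DN}(\mathrm{MSO}_k),\mathrm{LS}(\mathrm{MSO}_k),\mathrm{H}(\mathrm{MSO}_k)\le\mathrm{twr}(k+\log^*((k+1)^2)+1)$.
   Context: Words are nonempty finite words over $\Sigma=\{l,r\}$, identified with word models (positions with linear order $<$ and unary predicates $P_l,P_r$). FO and MSO formulas are over $\{<,P_l,P_r\}$. Quantifier rank: $0$ for atomic, unchanged by $\neg$, max over $\wedge,\vee$, each first- or second-order quantifier adds $1$; $\mathrm{FO}_k$, $\mathrm{MSO}_k$ are the formulas of quantifier rank at most $k$. A sentence defines $w$ if $w$ is its only model; $\mathrm{Def}(L)$ is the set of $L$-definable words, $\mathrm{DN}(L)=\max\{|w|:w\in\mathrm{Def}(L)\}$. $\mu(\phi)$ is the minimal length of a model of $\phi$ ($0$ if none); $\nu(\phi)$ is the maximal length of a model ($0$ if no models or arbitrarily long models). $\mathrm{LS}(L)=\max\{\mu(\phi):\phi\in L\}$, $\mathrm{H}(L)=\max\{\nu(\phi):\phi\in L\}$. $\mathrm{tower}(0)=1$, $\mathrm{tower}(n+1)=2^{\mathrm{tower}(n)}$; $\mathrm{twr}(x)=\mathrm{tower}(\lceil x\rceil)$; $\log^*(x)$ is the least $m$ with $\mathrm{tower}(m)\ge x$. -}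

module Defs where

open import Data.Nat using (ℕ; zero; suc; _+_; _*_; _^_; _≤_; _<_; _≤ᵇ_)
open import Data.Bool using (Bool; true; false; if_then_else_)
open import Data.Fin using (Fin)
open import Data.Fin.Base using () renaming (_<_ to _<ᶠ_)
open import Data.Vec using (Vec; []; _∷_; lookup)
open import Data.List using (List)
import Data.List as List
open import Data.List.NonEmpty using (List⁺; toList)
open import Data.Product using (Σ; _×_; _,_; ∃)
open import Data.Sum using (_⊎_)
open import Data.Empty using (⊥)
open import Relation.Binary.PropositionalEquality using (_≡_)

data Letter : Set where
  l r : Letter

Word : Set
Word = List⁺ Letter

len : Word → ℕ
len w = List.length (toList w)

Pos : Word → Set
Pos w = Fin (len w)

letterAt : (w : Word) → Pos w → Letter
letterAt w i = List.lookup (toList w) i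

-- Variables are de Bruijn indices: Formula L m n has m first-order and
-- n second-order (set) variables in scope.

data Logic : Set where
  FO MSO : Logic

data Formula : Logic → ℕ → ℕ → Set where
  lt   : ∀ {L m n} → Fin m → Fin m → Formula L m n
  eq   : ∀ {L m n} → Fin m → Fin m → Formula L m n
  Pl   : ∀ {L m n} → Fin m → Formula L m n
  Pr   : ∀ {L m n} → Fin m → Formula L m n
  mem  : ∀ {m n} → Fin n → Fin m → Formula MSO m n
  neg  : ∀ {L m n} → Formula L m n → Formula L m n
  conj : ∀ {L m n} → Formula L m n → Formula L m n → Formula L m n
  disj : ∀ {L m n} → Formula L m n → Formula L m n → Formula L m n
  ex1  : ∀ {L m n} → Formula L (suc m) n → Formula L m n
  all1 : ∀ {L m n} → Formula L (suc m) n → Formula L m n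
  ex2  : ∀ {m n} → Formula MSO m (suc n) → Formula MSO m n
  all2 : ∀ {m n} → Formula MSO m (suc n) → Formula MSO m n

Sentence : Logic → Set
Sentence L = Formula L 0 0

qr : ∀ {L m n} → Formula L m n → ℕ
qr (lt _ _)     = 0
qr (eq _ _)     = 0
qr (Pl _)       = 0
qr (Pr _)       = 0
qr (mem _ _)    = 0
qr (neg φ)      = qr φ
qr (conj φ ψ)   = qr φ Data.Nat.⊔ qr ψ
qr (disj φ ψ)   = qr φ Data.Nat.⊔ qr ψ
qr (ex1 φ)      = suc (qr φ)
qr (all1 φ)     = suc (qr φ)
qr (ex2 φ)      = suc (qr φ)
qr (all2 φ)     = suc (qr φ)

Sat : ∀ {L m n} (w : Word) → Vec (Pos w) m → Vec (Pos w → Bool) n →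
      Formula L m n → Set
Sat w ρ σ (lt x y)   = lookup ρ x <ᶠ lookup ρ y
Sat w ρ σ (eq x y)   = lookup ρ x ≡ lookup ρ y
Sat w ρ σ (Pl x)     = letterAt w (lookup ρ x) ≡ l
Sat w ρ σ (Pr x)     = letterAt w (lookup ρ x) ≡ r
Sat w ρ σ (mem X x)  = lookup σ X (lookup ρ x) ≡ true
Sat w ρ σ (neg φ)    = Sat w ρ σ φ → ⊥
Sat w ρ σ (conj φ ψ) = Sat w ρ σ φ × Sat w ρ σ ψ
Sat w ρ σ (disj φ ψ) = Sat w ρ σ φ ⊎ Sat w ρ σ ψ
Sat w ρ σ (ex1 φ)    = Σ (Pos w) λ i → Sat w (i ∷ ρ) σ φ
Sat w ρ σ (all1 φ)   = (i : Pos w) → Sat w (i ∷ ρ) σ φ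
Sat w ρ σ (ex2 φ)    = Σ (Pos w → Bool) λ X → Sat w ρ (X ∷ σ) φ
Sat w ρ σ (all2 φ)   = (X : Pos w → Bool) → Sat w ρ (X ∷ σ) φ

_⊨_ : ∀ {L} → Word → Sentence L → Set
w ⊨ φ = Sat w [] [] φ

Defines : ∀ {L} → Sentence L → Word → Set
Defines φ w = (v : Word) → (v ⊨ φ → v ≡ w) × (v ≡ w → v ⊨ φ)

DefinableIn : Logic → ℕ → Word → Set
DefinableIn L k w = Σ (Sentence L) λ φ → qr φ ≤ k × Defines φ w

-- Bounds on DN, LS, H, unfolded as "max ≤ B  iff  every element ≤ B".

DNBound : Logic → ℕ → ℕ → Set
DNBound L k B = (w : Word) → DefinableIn L k w → len w ≤ B

MuBound : ∀ {L} → Sentence L → ℕ → Set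
MuBound φ B = (w : Word) → w ⊨ φ → Σ Word λ v → v ⊨ φ × len v ≤ B

-- ν(φ) ≤ B : if φ has a model longer than B, then φ has arbitrarily
-- long models (so ν(φ) = 0); otherwise all models have length ≤ B.
NuBound : ∀ {L} → Sentence L → ℕ → Set
NuBound φ B = (w : Word) → w ⊨ φ → B < len w →
              (n : ℕ) → Σ Word λ v → v ⊨ φ × n ≤ len v

LSBound : Logic → ℕ → ℕ → Set
LSBound L k B = (φ : Sentence L) → qr φ ≤ k → MuBound φ B

HBound : Logic → ℕ → ℕ → Set
HBound L k B = (φ : Sentence L) → qr φ ≤ k → NuBound φ B

tower : ℕ → ℕ
tower zero    = 1
tower (suc n) = 2 ^ tower n

logStarSearch : ℕ → ℕ → ℕ → ℕ
logStarSearch x zero    m = m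
logStarSearch x (suc f) m = if x ≤ᵇ tower m then m else logStarSearch x f (suc m)

-- log*(x) = least m with tower(m) ≥ x.  Since tower(x) ≥ x, the search
-- over m = 0, 1, …, x (fuel x) always finds it.
logStar : ℕ → ℕ
logStar x = logStarSearch x x 0

-- twr(x) = tower(⌈x⌉); all arguments below are natural numbers, so
-- the ceiling is the identity.
twr : ℕ → ℕ
twr = tower

-- Duplicator's winning strategies in the k-round Ehrenfeucht–Fraïssé game
-- compose along concatenation, and k-equivalent words satisfy the same
-- sentences of quantifier rank ≤ k.  Words of equal k-round type are
-- k-equivalent, and there are at most 2 ^ typeBits L k 0 0 types.  So a word w
-- longer than that has two nonempty prefixes u and ux of the same type;
-- writing w = uxz, composition makes every uxᵗz k-equivalent to w.  Taking
-- t = 0 gives a shorter model of any sentence w satisfies, large t arbitrarily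
-- long ones, and a definable word cannot be that long.  Finally
-- typeBits L k 0 0 ≤ tower (k + log* …) by induction on the number of rounds.
module Submission where

open import Defs
open import Data.Nat using (ℕ; zero; suc; _+_; _*_; _∸_; _^_; _≤_; _<_; z≤n; s≤s; _<?_; _≤?_; _≤ᵇ_)
open import Data.Nat.Properties
open import Data.Fin as Fin using (Fin; toℕ; fromℕ<)
open import Data.Fin.Properties using (toℕ<n; toℕ-injective; toℕ-fromℕ<; fromℕ<-toℕ; 2↔Bool; any?; remQuot-combine; finToFun-funToFin; pigeonhole)
open import Data.Fin.Subset.Properties using (anySubset?)
open import Data.Vec.Properties using (lookup∘tabulate; tabulate∘lookup; tabulate-cong; ++-injective)
open import Data.Vec as Vec using (Vec)
open import Data.List using (List; []; _∷_; applyUpTo)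
open import Data.List.Properties using (length-applyUpTo)
import Data.List as List
open import Data.List.NonEmpty using (toList) renaming (_∷_ to _∷⁺_)
open import Data.Vec.Functional using (Vector) renaming ([] to []ᶠ; _∷_ to _∷ᶠ_)
open import Data.Product using (Σ; ∃; ∃-syntax; _×_; _,_; proj₁; proj₂; map₂; uncurry)
open import Data.Sum using (inj₁; inj₂)
open import Data.Empty using (⊥-elim)
open import Data.Unit using (⊤; tt)
open import Data.Bool using (Bool; true; false)
open import Data.Bool.Properties using (T-≡)
open import Function using (_∘_; id)
open import Function.Bundles using (_⇔_; mk⇔; Equivalence; Inverse)
open import Function.Construct.Symmetry using (⇔-sym)
open import Function.Construct.Composition using (_⇔-∘_)
open import Relation.Nullary using (Dec; yes; no; does; contradiction)
open import Relation.Nullary.Decidable using (dec-true)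
open import Relation.Binary.PropositionalEquality
open import Data.Nat.Tactic.RingSolver using (solve-∀)
open import Relation.Binary.Definitions using (tri<; tri≈; tri>)

open Equivalence using (to; from)

private
  variable
    L : Logic
    j m m' s : ℕ

infixr 5 _⇔-⨾_
_⇔-⨾_ : ∀ {A B C : Set} → A ⇔ B → B ⇔ C → A ⇔ C
p ⇔-⨾ q = q ⇔-∘ p

-- Ehrenfeucht–Fraïssé games

-- A word model together with an assignment of its variables.  Positions
-- are natural numbers; a variable assigned a value ≥ n is simply absent
-- from the structure, which lets us shift assignments when splitting a
-- concatenation.
record Config (m s : ℕ) : Set where
  constructor config
  field
    n : ℕ
    f : ℕ → Letter
    ρ : Vector ℕ m
    σ : Vector (ℕ → Bool) s
open Config

addPos : Config m s → ℕ → Config (suc m) s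
addPos c i = config (n c) (f c) (i ∷ᶠ ρ c) (σ c)

addSet : Config m s → (ℕ → Bool) → Config m (suc s)
addSet c X = config (n c) (f c) (ρ c) (X ∷ᶠ σ c)

record SameAtoms (c d : Config m s) : Set where
  field
    range⇔  : ∀ x → (ρ c x < n c) ⇔ (ρ d x < n d)
    <⇔      : ∀ x y → ρ c x < n c → ρ c y < n c → ρ d x < n d → ρ d y < n d →
              (ρ c x < ρ c y) ⇔ (ρ d x < ρ d y)
    ≡⇔      : ∀ x y → ρ c x < n c → ρ c y < n c → ρ d x < n d → ρ d y < n d →
              (ρ c x ≡ ρ c y) ⇔ (ρ d x ≡ ρ d y)
    letter≡ : ∀ x → ρ c x < n c → ρ d x < n d → f c (ρ c x) ≡ f d (ρ d x)
    mem≡    : ∀ X x → ρ c x < n c → ρ d x < n d → σ c X (ρ c x) ≡ σ d X (ρ d x)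
open SameAtoms

SetMoves : Logic → ((ℕ → Bool) → (ℕ → Bool) → Set) → Set
SetMoves FO  R = ⊤
SetMoves MSO R = (∀ X → ∃[ Y ] R X Y) × (∀ Y → ∃[ X ] R X Y)

record Round (L : Logic) (R : ∀ {m s} → Config m s → Config m s → Set)
             {m s} (c d : Config m s) : Set where
  constructor round
  field
    atoms : SameAtoms c d
    forth : ∀ i → i < n c → ∃[ i' ] i' < n d × R (addPos c i) (addPos d i')
    back  : ∀ i' → i' < n d → ∃[ i ] i < n c × R (addPos c i) (addPos d i')
    sets  : SetMoves L (λ X Y → R (addSet c X) (addSet d Y))
open Round

EF : Logic → ℕ → ∀ {m s} → Config m s → Config m s → Set
EF L zero    = SameAtoms
EF L (suc j) = Round L (EF L j)

SetMoves-map : ∀ L {R R'} → (∀ {X Y} → R X Y → R' X Y) → SetMoves L R → SetMoves L R'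
SetMoves-map FO  h _       = tt
SetMoves-map MSO h (a , b) = map₂ h ∘ a , map₂ h ∘ b

SetMoves-diagonal : ∀ L {R} → (∀ X → R X X) → SetMoves L R
SetMoves-diagonal FO  h = tt
SetMoves-diagonal MSO h = (λ X → X , h X) , (λ X → X , h X)

SetMoves-swap : ∀ L {R R'} → (∀ {X Y} → R X Y → R' Y X) → SetMoves L R → SetMoves L R'
SetMoves-swap FO  h _       = tt
SetMoves-swap MSO h (a , b) = map₂ h ∘ b , map₂ h ∘ a

SetMoves-compose : ∀ L {R R' R''} → (∀ {X Y Z} → R X Y → R' Y Z → R'' X Z) →
                   SetMoves L R → SetMoves L R' → SetMoves L R''
SetMoves-compose FO  h _       _         = tt
SetMoves-compose MSO h (a , b) (a' , b') =
  (λ X → let Y , XY = a X in map₂ (h XY) (a' Y)) ,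
  (λ Z → let Y , YZ = b' Z in map₂ (λ XY → h XY YZ) (b Y))

EF-atoms : ∀ j {c d : Config m s} → EF L j c d → SameAtoms c d
EF-atoms zero    a = a
EF-atoms (suc j) g = atoms g

EF-weaken : ∀ j {c d : Config m s} → EF L (suc j) c d → EF L j c d
EF-weaken zero    g = atoms g
EF-weaken {L = L} (suc j) (round a fo ba sm) =
  round a (λ i → map₂ (map₂ (EF-weaken j)) ∘ fo i) (λ i' → map₂ (map₂ (EF-weaken j)) ∘ ba i')
    (SetMoves-map L (EF-weaken j) sm)

SameAtoms-sym : {c d : Config m s} → SameAtoms c d → SameAtoms d c
SameAtoms-sym a = record
  { range⇔  = λ x → ⇔-sym (range⇔ a x)
  ; <⇔      = λ x y p q p' q' → ⇔-sym (<⇔ a x y p' q' p q)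
  ; ≡⇔      = λ x y p q p' q' → ⇔-sym (≡⇔ a x y p' q' p q)
  ; letter≡ = λ x p p' → sym (letter≡ a x p' p)
  ; mem≡    = λ X x p p' → sym (mem≡ a X x p' p)
  }

EF-sym : ∀ j {c d : Config m s} → EF L j c d → EF L j d c
EF-sym zero    a = SameAtoms-sym a
EF-sym {L = L} (suc j) (round a fo ba sm) =
  round (SameAtoms-sym a) (λ i → map₂ (map₂ (EF-sym j)) ∘ ba i) (λ i' → map₂ (map₂ (EF-sym j)) ∘ fo i')
    (SetMoves-swap L (EF-sym j) sm)

SameAtoms-trans : {c d e : Config m s} → SameAtoms c d → SameAtoms d e → SameAtoms c e
SameAtoms-trans {c = c} {d} a b = record
  { range⇔  = λ x → range⇔ a x ⇔-⨾ range⇔ b x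
  ; <⇔      = λ x y p q p'' q'' → <⇔ a x y p q (mid x p) (mid y q) ⇔-⨾ <⇔ b x y (mid x p) (mid y q) p'' q''
  ; ≡⇔      = λ x y p q p'' q'' → ≡⇔ a x y p q (mid x p) (mid y q) ⇔-⨾ ≡⇔ b x y (mid x p) (mid y q) p'' q''
  ; letter≡ = λ x p p'' → trans (letter≡ a x p (mid x p)) (letter≡ b x (mid x p) p'')
  ; mem≡    = λ X x p p'' → trans (mem≡ a X x p (mid x p)) (mem≡ b X x (mid x p) p'')
  }
  where
  mid : ∀ x → ρ c x < n c → ρ d x < n d
  mid x = to (range⇔ a x)

EF-trans : ∀ j {c d e : Config m s} → EF L j c d → EF L j d e → EF L j c e
EF-trans zero    a b = SameAtoms-trans a b
EF-trans {L = L} (suc j) {c} {d} {e} (round a fo ba sm) (round a' fo' ba' sm') =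
  round (SameAtoms-trans a a') forth′ back′ (SetMoves-compose L (EF-trans j) sm sm')
  where
  forth′ : ∀ i → i < n c → ∃[ i₂ ] i₂ < n e × EF L j (addPos c i) (addPos e i₂)
  forth′ i p = let i₁ , p₁ , g₁ = fo i p ; i₂ , p₂ , g₂ = fo' i₁ p₁ in i₂ , p₂ , EF-trans j g₁ g₂
  back′ : ∀ i₂ → i₂ < n e → ∃[ i ] i < n c × EF L j (addPos c i) (addPos e i₂)
  back′ i₂ p₂ = let i₁ , p₁ , g₂ = ba' i₂ p₂ ; i , p , g₁ = ba i₁ p₁ in i , p , EF-trans j g₁ g₂

AgreeBelow : {A : Set} → ℕ → (ℕ → A) → (ℕ → A) → Set
AgreeBelow n g h = ∀ i → i < n → g i ≡ h i

SetsAgreeBelow : ℕ → Vector (ℕ → Bool) s → Vector (ℕ → Bool) s → Set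
SetsAgreeBelow n σ σ' = ∀ X → AgreeBelow n (σ X) (σ' X)

SetsAgreeBelow-∷ : ∀ {n} {σ σ' : Vector (ℕ → Bool) s} X →
                   SetsAgreeBelow n σ σ' → SetsAgreeBelow n (X ∷ᶠ σ) (X ∷ᶠ σ')
SetsAgreeBelow-∷ X as Fin.zero    _ _ = refl
SetsAgreeBelow-∷ X as (Fin.suc Y)     = as Y

module _ {n : ℕ} {f f' : ℕ → Letter} {ρ : Vector ℕ m} {σ σ' : Vector (ℕ → Bool) s} where

  SameAtoms-agree : AgreeBelow n f f' → SetsAgreeBelow n σ σ' →
                    SameAtoms (config n f ρ σ) (config n f' ρ σ')
  SameAtoms-agree af as = record
    { range⇔  = λ _ → mk⇔ id id
    ; <⇔      = λ _ _ _ _ _ _ → mk⇔ id id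
    ; ≡⇔      = λ _ _ _ _ _ _ → mk⇔ id id
    ; letter≡ = λ x p _ → af (ρ x) p
    ; mem≡    = λ X x p _ → as X (ρ x) p
    }

EF-agree : ∀ j {n f f'} {ρ : Vector ℕ m} {σ σ' : Vector (ℕ → Bool) s} →
           AgreeBelow n f f' → SetsAgreeBelow n σ σ' →
           EF L j (config n f ρ σ) (config n f' ρ σ')
EF-agree zero    af as = SameAtoms-agree af as
EF-agree {L = L} (suc j) af as =
  round (SameAtoms-agree af as) (λ i p → i , p , EF-agree j af as) (λ i p → i , p , EF-agree j af as)
    (SetMoves-diagonal L (λ X → EF-agree j af (SetsAgreeBelow-∷ X as)))

EF-refl : ∀ j (c : Config m s) → EF L j c c
EF-refl j c = EF-agree j (λ _ _ → refl) (λ _ _ _ → refl)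

data Inherited (n n' : ℕ) (ρ ρ' : Vector ℕ m) (a a' : ℕ) : Set where
  absent : n ≤ a → n' ≤ a' → Inherited n n' ρ ρ' a a'
  copy   : ∀ x → a ≡ ρ x → a' ≡ ρ' x → Inherited n n' ρ ρ' a a'

Inherited-∷ : ∀ {n n' i i' a a'} {ρ ρ' : Vector ℕ m} →
              Inherited n n' ρ ρ' a a' → Inherited n n' (i ∷ᶠ ρ) (i' ∷ᶠ ρ') a a'
Inherited-∷ (absent p p') = absent p p'
Inherited-∷ (copy x e e') = copy (Fin.suc x) e e'

Inherited-present : ∀ {n n' a a'} {ρ ρ' : Vector ℕ m} →
                    Inherited n n' ρ ρ' a a' → a < n → ∃[ x ] a ≡ ρ x × a' ≡ ρ' x
Inherited-present (absent p _) h = contradiction p (<⇒≱ h)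
Inherited-present (copy x e e') _ = x , e , e'

module _ {n n' : ℕ} {f f' : ℕ → Letter} {ρ ρ' : Vector ℕ m} {σ σ' : Vector (ℕ → Bool) s}
         (A : SameAtoms (config n f ρ σ) (config n' f' ρ' σ')) where

  private
    I : ℕ → ℕ → Set
    I = Inherited n n' ρ ρ'

  range⇔-inherited : ∀ {a a'} → I a a' → (a < n) ⇔ (a' < n')
  range⇔-inherited (absent p p')      = mk⇔ (λ h → contradiction p (<⇒≱ h)) (λ h → contradiction p' (<⇒≱ h))
  range⇔-inherited (copy x refl refl) = range⇔ A x

  <⇔-inherited : ∀ {a a' b b'} → I a a' → I b b' → a < n → b < n → a' < n' → b' < n' →
                 (a < b) ⇔ (a' < b')
  <⇔-inherited ia ib p q p' q' with Inherited-present ia p | Inherited-present ib q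
  ... | x , refl , refl | y , refl , refl = <⇔ A x y p q p' q'

  ≡⇔-inherited : ∀ {a a' b b'} → I a a' → I b b' → a < n → b < n → a' < n' → b' < n' →
                 (a ≡ b) ⇔ (a' ≡ b')
  ≡⇔-inherited ia ib p q p' q' with Inherited-present ia p | Inherited-present ib q
  ... | x , refl , refl | y , refl , refl = ≡⇔ A x y p q p' q'

  letter≡-inherited : ∀ {a a'} → I a a' → a < n → a' < n' → f a ≡ f' a'
  letter≡-inherited ia p p' with Inherited-present ia p
  ... | x , refl , refl = letter≡ A x p p'

  mem≡-inherited : ∀ {a a'} X → I a a' → a < n → a' < n' → σ X a ≡ σ' X a'
  mem≡-inherited X ia p p' with Inherited-present ia p
  ... | x , refl , refl = mem≡ A X x p p'

  SameAtoms-reindex : {ρ̃ ρ̃' : Vector ℕ m'} → (∀ x → I (ρ̃ x) (ρ̃' x)) →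
                      SameAtoms (config n f ρ̃ σ) (config n' f' ρ̃' σ')
  SameAtoms-reindex inh = record
    { range⇔  = λ x → range⇔-inherited (inh x)
    ; <⇔      = λ x y → <⇔-inherited (inh x) (inh y)
    ; ≡⇔      = λ x y → ≡⇔-inherited (inh x) (inh y)
    ; letter≡ = λ x → letter≡-inherited (inh x)
    ; mem≡    = λ X x → mem≡-inherited X (inh x)
    }

EF-reindex : ∀ j {n n' f f'} {ρ ρ' : Vector ℕ m} {ρ̃ ρ̃' : Vector ℕ m'}
             {σ σ' : Vector (ℕ → Bool) s} →
             (∀ x → Inherited n n' ρ ρ' (ρ̃ x) (ρ̃' x)) →
             EF L j (config n f ρ σ) (config n' f' ρ' σ') →
             EF L j (config n f ρ̃ σ) (config n' f' ρ̃' σ')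
EF-reindex zero    inh a = SameAtoms-reindex a inh
EF-reindex {L = L} (suc j) inh (round a fo ba sm) =
  round (SameAtoms-reindex a inh)
    (λ i p → let i' , p' , g = fo i p in i' , p' , EF-reindex j (reindex-∷ inh) g)
    (λ i' p' → let i , p , g = ba i' p' in i , p , EF-reindex j (reindex-∷ inh) g)
    (SetMoves-map L (EF-reindex j inh) sm)
  where
  reindex-∷ : ∀ {n n' i i'} {ρ ρ' : Vector ℕ m} {ρ̃ ρ̃' : Vector ℕ m'} →
              (∀ x → Inherited n n' ρ ρ' (ρ̃ x) (ρ̃' x)) →
              ∀ x → Inherited n n' (i ∷ᶠ ρ) (i' ∷ᶠ ρ') ((i ∷ᶠ ρ̃) x) ((i' ∷ᶠ ρ̃') x)
  reindex-∷ inh Fin.zero    = copy Fin.zero refl refl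
  reindex-∷ inh (Fin.suc x) = Inherited-∷ (inh x)

-- Composition

m<k+n⇔m∸k<n : ∀ {k m n} → k ≤ m → (m < k + n) ⇔ (m ∸ k < n)
m<k+n⇔m∸k<n {k} {m} {n} k≤m =
  mk⇔ (λ h → subst (m ∸ k <_) (m+n∸m≡n k n) (∸-monoˡ-< h k≤m))
      (λ h → subst (_< k + n) (m+[n∸m]≡n k≤m) (+-monoʳ-< k h))

m<n⇔m∸k<n∸k : ∀ {k m n} → k ≤ m → k ≤ n → (m < n) ⇔ (m ∸ k < n ∸ k)
m<n⇔m∸k<n∸k {k} k≤m k≤n =
  mk⇔ (λ h → ∸-monoˡ-< h k≤m)
      (λ h → subst₂ _<_ (m+[n∸m]≡n k≤m) (m+[n∸m]≡n k≤n) (+-monoʳ-< k h))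

m≡n⇔m∸k≡n∸k : ∀ {k m n} → k ≤ m → k ≤ n → (m ≡ n) ⇔ (m ∸ k ≡ n ∸ k)
m≡n⇔m∸k≡n∸k {k} k≤m k≤n = mk⇔ (cong (_∸ k)) (∸-cancelʳ-≡ k≤m k≤n)

append : {A : Set} → ℕ → (ℕ → A) → (ℕ → A) → ℕ → A
append k g h a with a <? k
... | yes _ = g a
... | no  _ = h (a ∸ k)

module _ {A : Set} {k : ℕ} {g h : ℕ → A} where

  append-< : ∀ {a} → a < k → append k g h a ≡ g a
  append-< {a} a<k with a <? k
  ... | yes _   = refl
  ... | no  a≮k = contradiction a<k a≮k

  append-≥ : ∀ {a} → k ≤ a → append k g h a ≡ h (a ∸ k)
  append-≥ {a} k≤a with a <? k
  ... | yes a<k = contradiction k≤a (<⇒≱ a<k)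
  ... | no  _   = refl

  append-+ : ∀ b → append k g h (k + b) ≡ h b
  append-+ b = trans (append-≥ (m≤m+n k b)) (cong h (m+n∸m≡n k b))

append-split : {A : Set} (k : ℕ) (g : ℕ → A) → ∀ a → append k g (g ∘ (k +_)) a ≡ g a
append-split k g a with a <? k
... | yes _   = refl
... | no  a≮k = cong g (m+[n∸m]≡n (≮⇒≥ a≮k))

-- The assignment as seen from the second factor of a concatenation whose
-- first factor has length k; variables in the first factor are sent to the
-- absent position n.
suffixPos : ℕ → ℕ → Vector ℕ m → Vector ℕ m
suffixPos k n ρ = append k (λ _ → n) id ∘ ρ

suffixSets : ℕ → Vector (ℕ → Bool) s → Vector (ℕ → Bool) s
suffixSets k σ X i = σ X (k + i)

module _ {nA nA' nB nB' : ℕ} {fA fA' fB fB' : ℕ → Letter} {ρ ρ' : Vector ℕ m} {σ σ' : Vector (ℕ → Bool) s}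
         (A : SameAtoms (config nA fA ρ σ) (config nA' fA' ρ' σ'))
         (B : SameAtoms (config nB fB (suffixPos nA nB ρ) (suffixSets nA σ))
                        (config nB' fB' (suffixPos nA' nB' ρ') (suffixSets nA' σ'))) where

  private
    N N' : ℕ
    N  = nA + nB
    N' = nA' + nB'

  data Side (x : Fin m) : Set where
    inPrefix : ρ x < nA → ρ' x < nA' → Side x
    inSuffix : nA ≤ ρ x → nA' ≤ ρ' x → Side x

  side : ∀ x → Side x
  side x with ρ x <? nA
  ... | yes p = inPrefix p (to (range⇔ A x) p)
  ... | no  p = inSuffix (≮⇒≥ p) (≮⇒≥ (p ∘ from (range⇔ A x)))

  private
    inSuffix< : ∀ x → nA ≤ ρ x → ρ x < N → suffixPos nA nB ρ x < nB
    inSuffix< x p h = subst (_< nB) (sym (append-≥ p)) (to (m<k+n⇔m∸k<n p) h)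

    inSuffix<′ : ∀ x → nA' ≤ ρ' x → ρ' x < N' → suffixPos nA' nB' ρ' x < nB'
    inSuffix<′ x p h = subst (_< nB') (sym (append-≥ p)) (to (m<k+n⇔m∸k<n p) h)

    unshift : ∀ (_~_ : ℕ → ℕ → Set) {a b a' b'} → nA ≤ a → nA ≤ b → nA' ≤ a' → nA' ≤ b' →
              (append nA (λ _ → nB) id a ~ append nA (λ _ → nB) id b) ⇔
              (append nA' (λ _ → nB') id a' ~ append nA' (λ _ → nB') id b') →
              ((a ∸ nA) ~ (b ∸ nA)) ⇔ ((a' ∸ nA') ~ (b' ∸ nA'))
    unshift _~_ {a} {b} {a'} {b'} p q p' q' =
      subst₂ (λ u u' → (u ~ (b ∸ nA)) ⇔ (u' ~ (b' ∸ nA'))) (append-≥ p) (append-≥ p')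
        ∘ subst₂ (λ v v' → (append nA (λ _ → nB) id a ~ v) ⇔ (append nA' (λ _ → nB') id a' ~ v'))
            (append-≥ q) (append-≥ q')

  range⇔-append : ∀ x → (ρ x < N) ⇔ (ρ' x < N')
  range⇔-append x with side x
  ... | inPrefix p p' = mk⇔ (λ _ → <-≤-trans p' (m≤m+n nA' nB')) (λ _ → <-≤-trans p (m≤m+n nA nB))
  ... | inSuffix p p' =
    m<k+n⇔m∸k<n p
      ⇔-⨾ subst₂ (λ u u' → (u < nB) ⇔ (u' < nB')) (append-≥ p) (append-≥ p') (range⇔ B x)
      ⇔-⨾ ⇔-sym (m<k+n⇔m∸k<n p')

  <⇔-append : ∀ x y → ρ x < N → ρ y < N → ρ' x < N' → ρ' y < N' → (ρ x < ρ y) ⇔ (ρ' x < ρ' y)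
  <⇔-append x y h₁ h₂ h₃ h₄ with side x | side y
  ... | inPrefix p p' | inPrefix q q' = <⇔ A x y p q p' q'
  ... | inPrefix p p' | inSuffix q q' = mk⇔ (λ _ → <-≤-trans p' q') (λ _ → <-≤-trans p q)
  ... | inSuffix p p' | inPrefix q q' =
    mk⇔ (λ h → contradiction (<-≤-trans q p) (<-asym h)) (λ h → contradiction (<-≤-trans q' p') (<-asym h))
  ... | inSuffix p p' | inSuffix q q' =
    m<n⇔m∸k<n∸k p q
      ⇔-⨾ unshift _<_ p q p' q' (<⇔ B x y (inSuffix< x p h₁) (inSuffix< y q h₂) (inSuffix<′ x p' h₃) (inSuffix<′ y q' h₄))
      ⇔-⨾ ⇔-sym (m<n⇔m∸k<n∸k p' q')

  ≡⇔-append : ∀ x y → ρ x < N → ρ y < N → ρ' x < N' → ρ' y < N' → (ρ x ≡ ρ y) ⇔ (ρ' x ≡ ρ' y)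
  ≡⇔-append x y h₁ h₂ h₃ h₄ with side x | side y
  ... | inPrefix p p' | inPrefix q q' = ≡⇔ A x y p q p' q'
  ... | inPrefix p p' | inSuffix q q' =
    mk⇔ (λ e → contradiction e (<⇒≢ (<-≤-trans p q))) (λ e → contradiction e (<⇒≢ (<-≤-trans p' q')))
  ... | inSuffix p p' | inPrefix q q' =
    mk⇔ (λ e → contradiction (sym e) (<⇒≢ (<-≤-trans q p))) (λ e → contradiction (sym e) (<⇒≢ (<-≤-trans q' p')))
  ... | inSuffix p p' | inSuffix q q' =
    m≡n⇔m∸k≡n∸k p q
      ⇔-⨾ unshift _≡_ p q p' q' (≡⇔ B x y (inSuffix< x p h₁) (inSuffix< y q h₂) (inSuffix<′ x p' h₃) (inSuffix<′ y q' h₄))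
      ⇔-⨾ ⇔-sym (m≡n⇔m∸k≡n∸k p' q')

  letter≡-append : ∀ x → ρ x < N → ρ' x < N' → append nA fA fB (ρ x) ≡ append nA' fA' fB' (ρ' x)
  letter≡-append x h h' with side x
  ... | inPrefix p p' = trans (append-< p) (trans (letter≡ A x p p') (sym (append-< p')))
  ... | inSuffix p p' = begin
    append nA fA fB (ρ x)          ≡⟨ append-≥ p ⟩
    fB (ρ x ∸ nA)                  ≡⟨ cong fB (append-≥ p) ⟨
    fB (suffixPos nA nB ρ x)       ≡⟨ letter≡ B x (inSuffix< x p h) (inSuffix<′ x p' h') ⟩
    fB' (suffixPos nA' nB' ρ' x)   ≡⟨ cong fB' (append-≥ p') ⟩
    fB' (ρ' x ∸ nA')               ≡⟨ append-≥ p' ⟨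
    append nA' fA' fB' (ρ' x)      ∎
    where open ≡-Reasoning

  mem≡-append : ∀ X x → ρ x < N → ρ' x < N' → σ X (ρ x) ≡ σ' X (ρ' x)
  mem≡-append X x h h' with side x
  ... | inPrefix p p' = mem≡ A X x p p'
  ... | inSuffix p p' = begin
    σ X (ρ x)                             ≡⟨ cong (σ X) (m+[n∸m]≡n p) ⟨
    σ X (nA + (ρ x ∸ nA))                 ≡⟨ cong (σ X ∘ (nA +_)) (append-≥ p) ⟨
    σ X (nA + suffixPos nA nB ρ x)        ≡⟨ mem≡ B X x (inSuffix< x p h) (inSuffix<′ x p' h') ⟩
    σ' X (nA' + suffixPos nA' nB' ρ' x)   ≡⟨ cong (σ' X ∘ (nA' +_)) (append-≥ p') ⟩
    σ' X (nA' + (ρ' x ∸ nA'))             ≡⟨ cong (σ' X) (m+[n∸m]≡n p') ⟩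
    σ' X (ρ' x)                           ∎
    where open ≡-Reasoning

  SameAtoms-append : SameAtoms (config N (append nA fA fB) ρ σ) (config N' (append nA' fA' fB') ρ' σ')
  SameAtoms-append = record
    { range⇔  = range⇔-append
    ; <⇔      = <⇔-append
    ; ≡⇔      = ≡⇔-append
    ; letter≡ = letter≡-append
    ; mem≡    = mem≡-append
    }

concat : Config m s → ℕ → (ℕ → Letter) → Config m s
concat c nB fB = config (n c + nB) (append (n c) (f c) fB) (ρ c) (σ c)

suffixView : Config m s → ℕ → (ℕ → Letter) → Config m s
suffixView c nB fB = config nB fB (suffixPos (n c) nB (ρ c)) (suffixSets (n c) (σ c))

EF-≗ : ∀ j {n n' f f'} {ρ ρ' ρ̃ ρ̃' : Vector ℕ m} {σ σ' : Vector (ℕ → Bool) s} →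
       ρ̃ ≗ ρ → ρ̃' ≗ ρ' → EF L j (config n f ρ σ) (config n' f' ρ' σ') →
       EF L j (config n f ρ̃ σ) (config n' f' ρ̃' σ')
EF-≗ j e e' = EF-reindex j (λ x → copy x (e x) (e' x))

mutual
  EF-append : ∀ j {c c' : Config m s} {nB nB' fB fB'} →
              EF L j c c' → EF L j (suffixView c nB fB) (suffixView c' nB' fB') →
              EF L j (concat c nB fB) (concat c' nB' fB')
  EF-append zero gA gB = SameAtoms-append gA gB
  EF-append {L = L} (suc j) gA gB =
    round (SameAtoms-append (atoms gA) (atoms gB)) (forth-append j gA gB)
      (λ i' p' → map₂ (map₂ (EF-sym j)) (forth-append j (EF-sym (suc j) gA) (EF-sym (suc j) gB) i' p'))
      (setMoves-append L j gA gB)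

  forth-append : ∀ j {c c' : Config m s} {nB nB' fB fB'} →
    EF L (suc j) c c' → EF L (suc j) (suffixView c nB fB) (suffixView c' nB' fB') →
    ∀ i → i < n c + nB → ∃[ i' ] i' < n c' + nB' ×
      EF L j (addPos (concat c nB fB) i) (addPos (concat c' nB' fB') i')
  forth-append j {c} {c'} {nB} {nB'} gA gB i p with i <? n c
  ... | yes i<nA =
    let i' , i'<nA' , gA' = forth gA i i<nA
        newAbsent : ∀ x → Inherited nB nB' (suffixPos (n c) nB (ρ c)) (suffixPos (n c') nB' (ρ c'))
                            (suffixPos (n c) nB (i ∷ᶠ ρ c) x) (suffixPos (n c') nB' (i' ∷ᶠ ρ c') x)
        newAbsent = λ { Fin.zero    → absent (≤-reflexive (sym (append-< i<nA))) (≤-reflexive (sym (append-< i'<nA')))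
                      ; (Fin.suc y) → copy y refl refl }
    in i' , <-≤-trans i'<nA' (m≤m+n _ nB') , EF-append j gA' (EF-reindex j newAbsent (EF-weaken j gB))
  ... | no i≮nA =
    let nA≤i = ≮⇒≥ i≮nA
        k' , k'<nB' , gB' = forth gB (i ∸ n c) (to (m<k+n⇔m∸k<n nA≤i) p)
        newAbsent : ∀ x → Inherited (n c) (n c') (ρ c) (ρ c') ((i ∷ᶠ ρ c) x) ((n c' + k' ∷ᶠ ρ c') x)
        newAbsent = λ { Fin.zero    → absent nA≤i (m≤m+n (n c') k')
                      ; (Fin.suc y) → copy y refl refl }
        shifted : suffixPos (n c) nB (i ∷ᶠ ρ c) ≗ (i ∸ n c) ∷ᶠ suffixPos (n c) nB (ρ c)
        shifted = λ { Fin.zero → append-≥ nA≤i ; (Fin.suc y) → refl }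
        shifted' : suffixPos (n c') nB' (n c' + k' ∷ᶠ ρ c') ≗ k' ∷ᶠ suffixPos (n c') nB' (ρ c')
        shifted' = λ { Fin.zero → append-+ {k = n c'} {h = id} k' ; (Fin.suc y) → refl }
    in n c' + k' , +-monoʳ-< (n c') k'<nB' ,
       EF-append j (EF-reindex j newAbsent (EF-weaken j gA)) (EF-≗ j shifted shifted' gB')

  setMoves-append : ∀ L j {c c' : Config m s} {nB nB' fB fB'} →
    EF L (suc j) c c' → EF L (suc j) (suffixView c nB fB) (suffixView c' nB' fB') →
    SetMoves L (λ X Y → EF L j (addSet (concat c nB fB) X) (addSet (concat c' nB' fB') Y))
  setMoves-append FO  j gA gB = tt
  setMoves-append MSO j gA gB =
    setForth-append j gA gB ,
    (λ Y → map₂ (EF-sym j) (setForth-append j (EF-sym (suc j) gA) (EF-sym (suc j) gB) Y))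

  setForth-append : ∀ j {c c' : Config m s} {nB nB' fB fB'} →
    EF MSO (suc j) c c' → EF MSO (suc j) (suffixView c nB fB) (suffixView c' nB' fB') →
    ∀ X → ∃[ Y ] EF MSO j (addSet (concat c nB fB) X) (addSet (concat c' nB' fB') Y)
  setForth-append j {c} {c'} {nB} {nB'} gA gB X =
    let YA , gA' = proj₁ (sets gA) X
        YB , gB' = proj₁ (sets gB) (X ∘ (n c +_))
        Y = append (n c') YA YB
        prefixAgrees : SetsAgreeBelow (n c') (YA ∷ᶠ σ c') (Y ∷ᶠ σ c')
        prefixAgrees = λ { Fin.zero i p → sym (append-< p) ; (Fin.suc Z) i p → refl }
        suffixAgrees : SetsAgreeBelow nB' (YB ∷ᶠ suffixSets (n c') (σ c')) (suffixSets (n c') (Y ∷ᶠ σ c'))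
        suffixAgrees = λ { Fin.zero i p → sym (append-+ {k = n c'} {h = YB} i) ; (Fin.suc Z) i p → refl }
        shiftedX : SetsAgreeBelow nB (suffixSets (n c) (X ∷ᶠ σ c)) ((X ∘ (n c +_)) ∷ᶠ suffixSets (n c) (σ c))
        shiftedX = λ { Fin.zero i p → refl ; (Fin.suc Z) i p → refl }
    in Y , EF-append j (EF-trans j gA' (EF-agree j (λ _ _ → refl) prefixAgrees))
                       (EF-trans j (EF-agree j (λ _ _ → refl) shiftedX)
                          (EF-trans j gB' (EF-agree j (λ _ _ → refl) suffixAgrees)))

-- Games and satisfaction

-- The letter returned past the end is junk.
_‼_ : List Letter → ℕ → Letter
[]       ‼ _     = l
(a ∷ _)  ‼ zero  = a
(_ ∷ as) ‼ suc i = as ‼ i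

lookup≡‼ : ∀ (as : List Letter) (i : Fin (List.length as)) → List.lookup as i ≡ as ‼ toℕ i
lookup≡‼ (_ ∷ _)  Fin.zero    = refl
lookup≡‼ (_ ∷ as) (Fin.suc i) = lookup≡‼ as i

letters : Word → ℕ → Letter
letters w = toList w ‼_

extendSet : ∀ {k} → (Fin k → Bool) → ℕ → Bool
extendSet {k} X i with i <? k
... | yes i<k = X (fromℕ< i<k)
... | no  _   = false

extendSet-toℕ : ∀ {k} (X : Fin k → Bool) (i : Fin k) → extendSet X (toℕ i) ≡ X i
extendSet-toℕ {k} X i with toℕ i <? k
... | yes i<k = cong X (fromℕ<-toℕ i i<k)
... | no  i≮k = contradiction (toℕ<n i) i≮k

extendSet-restrict : ∀ {k} (X : ℕ → Bool) (X' : Fin k → Bool) → (∀ i → X' i ≡ X (toℕ i)) →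
                     AgreeBelow k (extendSet X') X
extendSet-restrict {k} X X' e i i<k with i <? k
... | yes i<k′ = trans (e (fromℕ< i<k′)) (cong X (toℕ-fromℕ< i<k′))
... | no  i≮k  = contradiction i<k i≮k

wordConfig : (w : Word) → Vec (Pos w) m → Vec (Pos w → Bool) s → Config m s
wordConfig w ρ σ = config (len w) (letters w) (toℕ ∘ Vec.lookup ρ) (extendSet ∘ Vec.lookup σ)

module _ (w w' : Word) (ρ : Vec (Pos w) m) (ρ' : Vec (Pos w') m)
         (σ : Vec (Pos w → Bool) s) (σ' : Vec (Pos w' → Bool) s) where

  letterAt≡ : ∀ j → EF L j (wordConfig w ρ σ) (wordConfig w' ρ' σ') →
              ∀ x → letterAt w (Vec.lookup ρ x) ≡ letterAt w' (Vec.lookup ρ' x)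
  letterAt≡ j g x = begin
    letterAt w (Vec.lookup ρ x)            ≡⟨ lookup≡‼ (toList w) (Vec.lookup ρ x) ⟩
    letters w (toℕ (Vec.lookup ρ x))       ≡⟨ letter≡ (EF-atoms j g) x (toℕ<n (Vec.lookup ρ x)) (toℕ<n (Vec.lookup ρ' x)) ⟩
    letters w' (toℕ (Vec.lookup ρ' x))     ≡⟨ lookup≡‼ (toList w') (Vec.lookup ρ' x) ⟨
    letterAt w' (Vec.lookup ρ' x)          ∎
    where open ≡-Reasoning

  forth-word : ∀ j → EF L (suc j) (wordConfig w ρ σ) (wordConfig w' ρ' σ') →
               ∀ i → ∃[ i' ] EF L j (wordConfig w (i Vec.∷ ρ) σ) (wordConfig w' (i' Vec.∷ ρ') σ')
  forth-word j g i =
    let i' , p' , g' = forth g (toℕ i) (toℕ<n i)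
    in fromℕ< p' , EF-≗ j (λ { Fin.zero → refl ; (Fin.suc x) → refl })
                          (λ { Fin.zero → toℕ-fromℕ< p' ; (Fin.suc x) → refl }) g'

  setForth-word : ∀ j → EF MSO (suc j) (wordConfig w ρ σ) (wordConfig w' ρ' σ') →
                  ∀ X → ∃[ Y ] EF MSO j (wordConfig w ρ (X Vec.∷ σ)) (wordConfig w' ρ' (Y Vec.∷ σ'))
  setForth-word j g X =
    let Ŷ , g' = proj₁ (sets g) (extendSet X)
        restricted : SetsAgreeBelow (len w') (Ŷ ∷ᶠ extendSet ∘ Vec.lookup σ')
                                             (extendSet ∘ Vec.lookup (Ŷ ∘ toℕ Vec.∷ σ'))
        restricted = λ { Fin.zero i p → sym (extendSet-restrict Ŷ (Ŷ ∘ toℕ) (λ _ → refl) i p) ; (Fin.suc Z) i p → refl }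
    in Ŷ ∘ toℕ , EF-trans j (EF-agree j (λ _ _ → refl) (λ { Fin.zero _ _ → refl ; (Fin.suc Z) _ _ → refl }))
                             (EF-trans j g' (EF-agree j (λ _ _ → refl) restricted))

EF-preserves-Sat : ∀ (φ : Formula L m s) j → qr φ ≤ j →
                   {w w' : Word} {ρ : Vec (Pos w) m} {ρ' : Vec (Pos w') m}
                   {σ : Vec (Pos w → Bool) s} {σ' : Vec (Pos w' → Bool) s} →
                   EF L j (wordConfig w ρ σ) (wordConfig w' ρ' σ') → Sat w ρ σ φ → Sat w' ρ' σ' φ
EF-preserves-Sat (lt x y) j _ {ρ = ρ} {ρ'} g h =
  to (<⇔ (EF-atoms j g) x y (toℕ<n (Vec.lookup ρ x)) (toℕ<n (Vec.lookup ρ y))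
                             (toℕ<n (Vec.lookup ρ' x)) (toℕ<n (Vec.lookup ρ' y))) h
EF-preserves-Sat (eq x y) j _ {ρ = ρ} {ρ'} g h =
  toℕ-injective (to (≡⇔ (EF-atoms j g) x y (toℕ<n (Vec.lookup ρ x)) (toℕ<n (Vec.lookup ρ y))
                                            (toℕ<n (Vec.lookup ρ' x)) (toℕ<n (Vec.lookup ρ' y))) (cong toℕ h))
EF-preserves-Sat (Pl x) j _ {w} {w'} {ρ} {ρ'} {σ} {σ'} g h = trans (sym (letterAt≡ w w' ρ ρ' σ σ' j g x)) h
EF-preserves-Sat (Pr x) j _ {w} {w'} {ρ} {ρ'} {σ} {σ'} g h = trans (sym (letterAt≡ w w' ρ ρ' σ σ' j g x)) h
EF-preserves-Sat (mem X x) j _ {ρ = ρ} {ρ'} {σ} {σ'} g h = begin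
  Vec.lookup σ' X (Vec.lookup ρ' x)                      ≡⟨ extendSet-toℕ (Vec.lookup σ' X) _ ⟨
  extendSet (Vec.lookup σ' X) (toℕ (Vec.lookup ρ' x))    ≡⟨ mem≡ (EF-atoms j g) X x (toℕ<n (Vec.lookup ρ x)) (toℕ<n (Vec.lookup ρ' x)) ⟨
  extendSet (Vec.lookup σ X) (toℕ (Vec.lookup ρ x))      ≡⟨ extendSet-toℕ (Vec.lookup σ X) _ ⟩
  Vec.lookup σ X (Vec.lookup ρ x)                        ≡⟨ h ⟩
  true                                                   ∎
  where open ≡-Reasoning
EF-preserves-Sat (neg φ) j q g h = h ∘ EF-preserves-Sat φ j q (EF-sym j g)
EF-preserves-Sat (conj φ ψ) j q g (h₁ , h₂) =
  EF-preserves-Sat φ j (m⊔n≤o⇒m≤o _ _ q) g h₁ , EF-preserves-Sat ψ j (m⊔n≤o⇒n≤o _ _ q) g h₂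
EF-preserves-Sat (disj φ ψ) j q g (inj₁ h) = inj₁ (EF-preserves-Sat φ j (m⊔n≤o⇒m≤o _ _ q) g h)
EF-preserves-Sat (disj φ ψ) j q g (inj₂ h) = inj₂ (EF-preserves-Sat ψ j (m⊔n≤o⇒n≤o _ _ q) g h)
EF-preserves-Sat (ex1 φ) (suc j) (s≤s q) {w} {w'} {ρ} {ρ'} {σ} {σ'} g (i , h) =
  let i' , g' = forth-word w w' ρ ρ' σ σ' j g i in i' , EF-preserves-Sat φ j q g' h
EF-preserves-Sat (all1 φ) (suc j) (s≤s q) {w} {w'} {ρ} {ρ'} {σ} {σ'} g h i' =
  let i , g' = forth-word w' w ρ' ρ σ' σ j (EF-sym (suc j) g) i' in EF-preserves-Sat φ j q (EF-sym j g') (h i)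
EF-preserves-Sat (ex2 φ) (suc j) (s≤s q) {w} {w'} {ρ} {ρ'} {σ} {σ'} g (X , h) =
  let Y , g' = setForth-word w w' ρ ρ' σ σ' j g X in Y , EF-preserves-Sat φ j q g' h
EF-preserves-Sat (all2 φ) (suc j) (s≤s q) {w} {w'} {ρ} {ρ'} {σ} {σ'} g h Y =
  let X , g' = setForth-word w' w ρ' ρ σ' σ j (EF-sym (suc j) g) Y in EF-preserves-Sat φ j q (EF-sym j g') (h X)

-- Types

code : ∀ {k} → Vec Bool k → Fin (2 ^ k)
code v = Fin.funToFin (Inverse.from 2↔Bool ∘ Vec.lookup v)

code-injective : ∀ {k} (u v : Vec Bool k) → code u ≡ code v → u ≡ v
code-injective u v e = begin
  u                            ≡⟨ tabulate∘lookup u ⟨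
  Vec.tabulate (Vec.lookup u)  ≡⟨ tabulate-cong bits ⟩
  Vec.tabulate (Vec.lookup v)  ≡⟨ tabulate∘lookup v ⟩
  v                            ∎
  where
  open ≡-Reasoning
  open Inverse 2↔Bool using (strictlyInverseˡ) renaming (to to bool; from to bit)
  bits : Vec.lookup u ≗ Vec.lookup v
  bits i = begin
    Vec.lookup u i                       ≡⟨ strictlyInverseˡ _ ⟨
    bool (bit (Vec.lookup u i))          ≡⟨ cong bool (finToFun-funToFin (bit ∘ Vec.lookup u) i) ⟨
    bool (Fin.finToFun (code u) i)       ≡⟨ cong (λ t → bool (Fin.finToFun t i)) e ⟩
    bool (Fin.finToFun (code v) i)       ≡⟨ cong bool (finToFun-funToFin (bit ∘ Vec.lookup v) i) ⟩
    bool (bit (Vec.lookup v i))          ≡⟨ strictlyInverseˡ _ ⟩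
    Vec.lookup v i                       ∎

tabulate-injective : ∀ {A : Set} {k} {F G : Fin k → A} → Vec.tabulate F ≡ Vec.tabulate G → F ≗ G
tabulate-injective {F = F} {G} e t =
  trans (sym (lookup∘tabulate F t)) (trans (cong (λ v → Vec.lookup v t) e) (lookup∘tabulate G t))

pairTable : ∀ {a b} → (Fin a → Fin b → Bool) → Vec Bool (a * b)
pairTable {b = b} F = Vec.tabulate (uncurry F ∘ Fin.remQuot b)

pairTable-injective : ∀ {a b} {F G : Fin a → Fin b → Bool} → pairTable F ≡ pairTable G → ∀ x y → F x y ≡ G x y
pairTable-injective {F = F} {G} e x y = begin
  F x y                                     ≡⟨ cong (uncurry F) (remQuot-combine x y) ⟨
  uncurry F (Fin.remQuot _ (Fin.combine x y)) ≡⟨ tabulate-injective e (Fin.combine x y) ⟩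
  uncurry G (Fin.remQuot _ (Fin.combine x y)) ≡⟨ cong (uncurry G) (remQuot-combine x y) ⟩
  G x y                                     ∎
  where open ≡-Reasoning

isL : Letter → Bool
isL l = true
isL r = false

isL-injective : ∀ {a b} → isL a ≡ isL b → a ≡ b
isL-injective {l} {l} _ = refl
isL-injective {r} {r} _ = refl

does-≡⇒⇔ : ∀ {A B : Set} (a? : Dec A) (b? : Dec B) → does a? ≡ does b? → A ⇔ B
does-≡⇒⇔ (yes a) (yes b) _ = mk⇔ (λ _ → b) (λ _ → a)
does-≡⇒⇔ (no ¬a) (no ¬b) _ = mk⇔ (⊥-elim ∘ ¬a) (⊥-elim ∘ ¬b)

does≡true⇒ : ∀ {A : Set} (a? : Dec A) → does a? ≡ true → A
does≡true⇒ (yes a) _ = a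

≡⇔-from-<⇔ : ∀ {a b a' b'} → (a < b) ⇔ (a' < b') → (b < a) ⇔ (b' < a') → (a ≡ b) ⇔ (a' ≡ b')
≡⇔-from-<⇔ ab ba = mk⇔ (≡-from (from ab) (from ba)) (≡-from (to ab) (to ba))
  where
  ≡-from : ∀ {a b a' b'} → (a' < b' → a < b) → (b' < a' → b < a) → a ≡ b → a' ≡ b'
  ≡-from {a' = a'} {b'} below above refl with <-cmp a' b'
  ... | tri< p _ _ = contradiction (below p) (<-irrefl refl)
  ... | tri≈ _ e _ = e
  ... | tri> _ _ p = contradiction (above p) (<-irrefl refl)

InRange : Config m s → Set
InRange c = ∀ x → ρ c x < n c

letterTable : Config m s → Vec Bool m
letterTable c = Vec.tabulate (λ x → isL (f c (ρ c x)))

orderTable : Config m s → Vec Bool (m * m)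
orderTable c = pairTable (λ x y → does (ρ c x <? ρ c y))

memTable : Config m s → Vec Bool (s * m)
memTable c = pairTable (λ X x → σ c X (ρ c x))

atomType : Config m s → Vec Bool (m + m * m + s * m)
atomType c = (letterTable c Vec.++ orderTable c) Vec.++ memTable c

SameAtoms-atomType : {c d : Config m s} → InRange c → InRange d → atomType c ≡ atomType d → SameAtoms c d
SameAtoms-atomType {c = c} {d} rc rd e = record
  { range⇔  = λ x → mk⇔ (λ _ → rd x) (λ _ → rc x)
  ; <⇔      = λ x y _ _ _ _ → <⇔′ x y
  ; ≡⇔      = λ x y _ _ _ _ → ≡⇔-from-<⇔ (<⇔′ x y) (<⇔′ y x)
  ; letter≡ = λ x _ _ → isL-injective (tabulate-injective letterTable≡ x)
  ; mem≡    = λ X x _ _ → pairTable-injective memTable≡ X x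
  }
  where
  letters,order≡ : letterTable c Vec.++ orderTable c ≡ letterTable d Vec.++ orderTable d
  letters,order≡ = proj₁ (++-injective (letterTable c Vec.++ orderTable c) _ e)
  memTable≡ : memTable c ≡ memTable d
  memTable≡ = proj₂ (++-injective (letterTable c Vec.++ orderTable c) _ e)
  letterTable≡ : letterTable c ≡ letterTable d
  letterTable≡ = proj₁ (++-injective (letterTable c) (letterTable d) letters,order≡)
  orderTable≡ : orderTable c ≡ orderTable d
  orderTable≡ = proj₂ (++-injective (letterTable c) (letterTable d) letters,order≡)
  <⇔′ : ∀ x y → (ρ c x < ρ c y) ⇔ (ρ d x < ρ d y)
  <⇔′ x y = does-≡⇒⇔ (ρ c x <? ρ c y) (ρ d x <? ρ d y) (pairTable-injective orderTable≡ x y)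

mutual
  typeBits : Logic → ℕ → ℕ → ℕ → ℕ
  typeBits L zero    m s = m + m * m + s * m
  typeBits L (suc j) m s = 2 ^ typeBits L j (suc m) s + setTypeBits L j m s

  setTypeBits : Logic → ℕ → ℕ → ℕ → ℕ
  setTypeBits FO  j m s = 0
  setTypeBits MSO j m s = 2 ^ typeBits MSO j m (suc s)

-- The j-round type of a configuration: bit t of posType (setType) records
-- whether some position (set) move leads to a configuration of type code t.
mutual
  type : ∀ L j → Config m s → Vec Bool (typeBits L j m s)
  type L zero    c = atomType c
  type L (suc j) c = posType L j c Vec.++ setType L j c

  posType : ∀ L j → Config m s → Vec Bool (2 ^ typeBits L j (suc m) s)
  posType L j c = Vec.tabulate (does ∘ posMove? L j c)

  setType : ∀ L j → Config m s → Vec Bool (setTypeBits L j m s)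
  setType FO  j c = Vec.[]
  setType MSO j c = Vec.tabulate (does ∘ setMove? j c)

  posMove? : ∀ L j (c : Config m s) t → Dec (∃[ i ] code (type L j (addPos c (toℕ {n c} i))) ≡ t)
  posMove? L j c t = any? λ i → code (type L j (addPos c (toℕ i))) Fin.≟ t

  setMove? : ∀ j (c : Config m s) t → Dec (∃[ S ] code (type MSO j (addSet c (extendSet {n c} (Vec.lookup S)))) ≡ t)
  setMove? j c t = anySubset? λ S → code (type MSO j (addSet c (extendSet (Vec.lookup S)))) Fin.≟ t

posType-forth : ∀ L j {c d : Config m s} → posType L j c ≡ posType L j d →
                ∀ i → i < n c → ∃[ i' ] i' < n d × type L j (addPos d i') ≡ type L j (addPos c i)
posType-forth L j {c} {d} e i i<n =
  let t = code (type L j (addPos c i))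
      realisedByC : does (posMove? L j c t) ≡ true
      realisedByC = dec-true (posMove? L j c t) (fromℕ< i<n , cong (λ a → code (type L j (addPos c a))) (toℕ-fromℕ< i<n))
      i' , e' = does≡true⇒ (posMove? L j d t) (trans (sym (tabulate-injective e t)) realisedByC)
  in toℕ i' , toℕ<n i' , code-injective _ _ e'

setType-forth : ∀ j {c d : Config m s} → setType MSO j c ≡ setType MSO j d →
                ∀ X → ∃[ X̂ ] AgreeBelow (n c) X̂ X × ∃[ Y ] type MSO j (addSet d Y) ≡ type MSO j (addSet c X̂)
setType-forth j {c} {d} e X =
  let S = Vec.tabulate (X ∘ toℕ)
      X̂ = extendSet (Vec.lookup S)
      t = code (type MSO j (addSet c X̂))
      realisedByC : does (setMove? j c t) ≡ true
      realisedByC = dec-true (setMove? j c t) (S , refl)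
      S' , e' = does≡true⇒ (setMove? j d t) (trans (sym (tabulate-injective e t)) realisedByC)
  in X̂ , extendSet-restrict X (Vec.lookup S) (lookup∘tabulate (X ∘ toℕ)) , extendSet (Vec.lookup S') , code-injective _ _ e'

InRange-addPos : ∀ {c : Config m s} {i} → InRange c → i < n c → InRange (addPos c i)
InRange-addPos rc i<n Fin.zero    = i<n
InRange-addPos rc i<n (Fin.suc x) = rc x

SameAtoms-tail : ∀ {c d : Config m s} {i i'} → SameAtoms (addPos c i) (addPos d i') → SameAtoms c d
SameAtoms-tail a = record
  { range⇔  = λ x → range⇔ a (Fin.suc x)
  ; <⇔      = λ x y → <⇔ a (Fin.suc x) (Fin.suc y)
  ; ≡⇔      = λ x y → ≡⇔ a (Fin.suc x) (Fin.suc y)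
  ; letter≡ = λ x → letter≡ a (Fin.suc x)
  ; mem≡    = λ X x → mem≡ a X (Fin.suc x)
  }

-- With at least one variable, all in range, Spoiler can move, and the atoms of
-- the extended configurations contain those of c and d.
SameAtoms-from-forth : ∀ j {c d : Config m s} → InRange c →
  (∀ i → i < n c → ∃[ i' ] i' < n d × EF L j (addPos c i) (addPos d i')) → SameAtoms c d
SameAtoms-from-forth {m = zero} j rc fo = record
  { range⇔ = λ () ; <⇔ = λ () ; ≡⇔ = λ () ; letter≡ = λ () ; mem≡ = λ _ () }
SameAtoms-from-forth {m = suc m} j {c} rc fo =
  let _ , _ , g = fo (ρ c Fin.zero) (rc Fin.zero) in SameAtoms-tail (EF-atoms j g)

setMoves-sameType : ∀ L j {c d : Config m s} →
  (∀ {c' d' : Config m (suc s)} → InRange c' → InRange d' → type L j c' ≡ type L j d' → EF L j c' d') →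
  InRange c → InRange d → setType L j c ≡ setType L j d →
  SetMoves L (λ X Y → EF L j (addSet c X) (addSet d Y))
setMoves-sameType FO  j ih rc rd e = tt
setMoves-sameType MSO j ih rc rd e =
  setForth rc rd e , (λ Y → map₂ (EF-sym j) (setForth rd rc (sym e) Y))
  where
  setForth : ∀ {c d : Config _ _} → InRange c → InRange d → setType MSO j c ≡ setType MSO j d →
             ∀ X → ∃[ Y ] EF MSO j (addSet c X) (addSet d Y)
  setForth {c} rc rd e X =
    let X̂ , X̂≈X , Y , e' = setType-forth j e X
        replaced : SetsAgreeBelow (n c) (X ∷ᶠ σ c) (X̂ ∷ᶠ σ c)
        replaced = λ { Fin.zero i p → sym (X̂≈X i p) ; (Fin.suc Z) i p → refl }
    in Y , EF-trans j (EF-agree j (λ _ _ → refl) replaced) (ih rc rd (sym e'))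

sameType⇒EF : ∀ L j {c d : Config m s} → InRange c → InRange d → type L j c ≡ type L j d → EF L j c d
sameType⇒EF L zero    rc rd e = SameAtoms-atomType rc rd e
sameType⇒EF L (suc j) {c} {d} rc rd e =
  round (SameAtoms-from-forth j rc forth′) forth′ back′
    (setMoves-sameType L j (sameType⇒EF L j) rc rd (proj₂ types≡))
  where
  types≡ : posType L j c ≡ posType L j d × setType L j c ≡ setType L j d
  types≡ = ++-injective (posType L j c) (posType L j d) e
  forth′ : ∀ i → i < n c → ∃[ i' ] i' < n d × EF L j (addPos c i) (addPos d i')
  forth′ i p =
    let i' , p' , e' = posType-forth L j (proj₁ types≡) i p
    in i' , p' , sameType⇒EF L j (InRange-addPos {c = c} rc p) (InRange-addPos {c = d} rd p') (sym e')
  back′ : ∀ i' → i' < n d → ∃[ i ] i < n c × EF L j (addPos c i) (addPos d i')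
  back′ i' p' =
    let i , p , e' = posType-forth L j (sym (proj₁ types≡)) i' p'
    in i , p , sameType⇒EF L j (InRange-addPos {c = c} rc p) (InRange-addPos {c = d} rd p') e'

-- Pumping

str : ℕ → (ℕ → Letter) → Config 0 0
str k g = config k g []ᶠ []ᶠ

-- Functions out of Fin 0 are not definitionally equal, so the empty
-- assignments of variable-free configurations are exchanged explicitly.
EF-unassigned : ∀ j {n n' f f'} {ρ₁ ρ₁' ρ₂ ρ₂' : Vector ℕ 0} {σ₁ σ₁' σ₂ σ₂' : Vector (ℕ → Bool) 0} →
                EF L j (config n f ρ₁ σ₁) (config n' f' ρ₁' σ₁') → EF L j (config n f ρ₂ σ₂) (config n' f' ρ₂' σ₂')
EF-unassigned j g =
  EF-trans j (EF-agree j (λ _ _ → refl) (λ ()))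
    (EF-trans j (EF-reindex j (λ ()) g) (EF-agree j (λ _ _ → refl) (λ ())))

EF-str : ∀ j {n n' f f'} → n ≡ n' → AgreeBelow n f f' → EF L j (str n f) (str n' f')
EF-str j refl f≈f' = EF-agree j f≈f' (λ ())

EF-· : ∀ j {a a' b b' g g' h h'} → EF L j (str a g) (str a' g') → EF L j (str b h) (str b' h') →
       EF L j (concat (str a g) b h) (concat (str a' g') b' h')
EF-· j gA gB = EF-append j gA (EF-unassigned j gB)

EF-split : ∀ j k n (g : ℕ → Letter) → EF L j (str (k + n) g) (concat (str k g) n (g ∘ (k +_)))
EF-split j k n g = EF-str j refl (λ i _ → sym (append-split k g i))

‼-applyUpTo : ∀ (g : ℕ → Letter) k i → i < k → applyUpTo g k ‼ i ≡ g i
‼-applyUpTo g (suc k) zero    _       = refl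
‼-applyUpTo g (suc k) (suc i) (s≤s p) = ‼-applyUpTo (g ∘ suc) k i p

toWord : ∀ k (g : ℕ → Letter) → 1 ≤ k → Σ Word λ v → len v ≡ k × AgreeBelow k g (letters v)
toWord (suc k) g _ =
  g 0 ∷⁺ applyUpTo (g ∘ suc) k , cong suc (length-applyUpTo (g ∘ suc) k) ,
  λ i p → sym (‼-applyUpTo g (suc k) i p)

EF-toWord : ∀ j k (g : ℕ → Letter) → 1 ≤ k → Σ Word λ v → len v ≡ k × EF L j (str k g) (wordConfig v Vec.[] Vec.[])
EF-toWord j k g 1≤k =
  let v , len-v , g≈v = toWord k g 1≤k
  in v , len-v , EF-unassigned j (EF-str j (sym len-v) g≈v)

module Pumping (L : Logic) (j : ℕ) (F : ℕ → Letter) (p d rest : ℕ)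
               (loop : EF L j (str p F) (str (p + d) F)) where

  u : Config 0 0
  u = str p F

  x : ℕ → Letter
  x = F ∘ (p +_)

  z : ℕ → Letter
  z = F ∘ ((p + d) +_)

  powerLength : ℕ → ℕ
  powerLength zero    = p
  powerLength (suc t) = powerLength t + d

  powerLetters : ℕ → ℕ → Letter
  powerLetters zero    = F
  powerLetters (suc t) = append (powerLength t) (powerLetters t) x

  power : ℕ → Config 0 0
  power t = str (powerLength t) (powerLetters t)

  loop′ : EF L j u (concat u d x)
  loop′ = EF-trans j loop (EF-split j p d F)

  EF-power : ∀ t → EF L j u (power t)
  EF-power zero    = EF-refl j u
  EF-power (suc t) = EF-trans j loop′ (EF-· j (EF-power t) (EF-refl j (str d x)))

  EF-pumped : ∀ t → EF L j (str (p + d + rest) F) (concat (power t) rest z)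
  EF-pumped t =
    EF-trans j (EF-split j (p + d) rest F)
      (EF-· j (EF-trans j (EF-sym j loop) (EF-power t)) (EF-refl j (str rest z)))

  powerLength-≥ : 1 ≤ d → ∀ t → p + t ≤ powerLength t
  powerLength-≥ 1≤d zero    = ≤-reflexive (+-identityʳ p)
  powerLength-≥ 1≤d (suc t) =
    ≤-trans (≤-reflexive (trans (+-suc p t) (+-comm 1 (p + t)))) (+-mono-≤ (powerLength-≥ 1≤d t) 1≤d)

record PrefixLoop (L : Logic) (j : ℕ) (F : ℕ → Letter) (N : ℕ) : Set where
  field
    p d    : ℕ
    1≤p    : 1 ≤ p
    1≤d    : 1 ≤ d
    p+d≤N  : p + d ≤ N
    loop   : EF L j (str p F) (str (p + d) F)

-- Pigeonhole on the types of the nonempty prefixes.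
prefixLoop : ∀ L j (w : Word) → 2 ^ typeBits L j 0 0 < len w → PrefixLoop L j (letters w) (len w)
prefixLoop L j w many =
  let F = letters w
      i , i' , i<i' , sameCode = pigeonhole many (λ i → code (type L j (str (suc (toℕ i)) F)))
      d = toℕ i' ∸ toℕ i
      p+d≡q : suc (toℕ i) + d ≡ suc (toℕ i')
      p+d≡q = cong suc (m+[n∸m]≡n (<⇒≤ i<i'))
  in record
    { p     = suc (toℕ i)
    ; d     = d
    ; 1≤p   = s≤s z≤n
    ; 1≤d   = m<n⇒0<n∸m i<i'
    ; p+d≤N = subst (_≤ len w) (sym p+d≡q) (toℕ<n i')
    ; loop  = subst (λ q → EF L j (str (suc (toℕ i)) F) (str q F)) (sym p+d≡q)
                (sameType⇒EF L j (λ ()) (λ ()) (code-injective _ _ sameCode))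
    }

_≈[_,_]_ : Word → Logic → ℕ → Word → Set
w ≈[ L , j ] v = EF L j (wordConfig w Vec.[] Vec.[]) (wordConfig v Vec.[] Vec.[])

module _ (L : Logic) (j : ℕ) (w : Word) (many : 2 ^ typeBits L j 0 0 < len w) where

  open PrefixLoop (prefixLoop L j w many)

  private
    rest : ℕ
    rest = len w ∸ (p + d)

    len-w : p + d + rest ≡ len w
    len-w = m+[n∸m]≡n p+d≤N

  open Pumping L j (letters w) p d rest loop

  pumpedWord : ∀ t → Σ Word λ v → len v ≡ powerLength t + rest × w ≈[ L , j ] v
  pumpedWord t =
    let nonempty = ≤-trans 1≤p (≤-trans (m≤m+n p t) (≤-trans (powerLength-≥ 1≤d t) (m≤m+n _ rest)))
        v , len-v , g = EF-toWord j (powerLength t + rest) (append (powerLength t) (powerLetters t) z) nonempty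
    in v , len-v ,
       EF-trans j (EF-unassigned j (EF-refl j (wordConfig w Vec.[] Vec.[])))
         (EF-trans j (EF-str j (sym len-w) (λ _ _ → refl)) (EF-trans j (EF-pumped t) g))

  shorterEquivalent : Σ Word λ v → len v < len w × w ≈[ L , j ] v
  shorterEquivalent =
    let v , len-v , g = pumpedWord 0
    in v , subst₂ _<_ (sym len-v) len-w (+-monoˡ-< rest (m<m+n p 1≤d)) , g

  longerEquivalent : ∀ t → Σ Word λ v → t + len w ≤ len v × w ≈[ L , j ] v
  longerEquivalent t =
    let v , len-v , g = pumpedWord (t + d)
    in v , subst₂ _≤_ (cong (t +_) len-w) (sym len-v)
             (≤-trans (≤-reflexive (regroup t p d rest)) (+-monoˡ-≤ rest (powerLength-≥ 1≤d (t + d)))) , g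
    where
    regroup : ∀ t p d rest → t + (p + d + rest) ≡ p + (t + d) + rest
    regroup = solve-∀

-- Counting types

n<2^n : ∀ n → n < 2 ^ n
n<2^n zero    = s≤s z≤n
n<2^n (suc n) = begin-strict
  suc n           ≤⟨ n<2^n n ⟩
  2 ^ n           <⟨ m<m+n (2 ^ n) (m^n>0 2 n) ⟩
  2 ^ n + 2 ^ n   ≡⟨ cong (2 ^ n +_) (+-identityʳ (2 ^ n)) ⟨
  2 ^ suc n       ∎
  where open ≤-Reasoning

n≤tower : ∀ n → n ≤ tower n
n≤tower zero    = z≤n
n≤tower (suc n) = ≤-trans (s≤s (n≤tower n)) (n<2^n (tower n))

logStarSearch-sound : ∀ x fuel m → x ≤ tower (m + fuel) → x ≤ tower (logStarSearch x fuel m)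
logStarSearch-sound x zero m h = subst (λ e → x ≤ tower e) (+-identityʳ m) h
logStarSearch-sound x (suc fuel) m h with x ≤ᵇ tower m in found
... | true  = ≤ᵇ⇒≤ x (tower m) (from T-≡ found)
... | false = logStarSearch-sound x fuel (suc m) (subst (λ e → x ≤ tower e) (+-suc m fuel) h)

≤tower-logStar : ∀ x → x ≤ tower (logStar x)
≤tower-logStar x = logStarSearch-sound x x 0 (n≤tower x)

2^x+suc[k]≤2^[x+k] : ∀ x k → 1 ≤ x → 1 ≤ k → 2 ^ x + suc k ≤ 2 ^ (x + k)
2^x+suc[k]≤2^[x+k] x k 1≤x 1≤k = begin
  2 ^ x + suc k         ≤⟨ +-monoʳ-≤ (2 ^ x) suc[k]≤2^x*k ⟩
  2 ^ x + 2 ^ x * k     ≡⟨ *-suc (2 ^ x) k ⟨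
  2 ^ x * suc k         ≤⟨ *-monoʳ-≤ (2 ^ x) (n<2^n k) ⟩
  2 ^ x * 2 ^ k         ≡⟨ ^-distribˡ-+-* 2 x k ⟨
  2 ^ (x + k)           ∎
  where
  open ≤-Reasoning
  suc[k]≤2^x*k : suc k ≤ 2 ^ x * k
  suc[k]≤2^x*k = begin
    suc k        ≤⟨ +-monoˡ-≤ k 1≤k ⟩
    k + k        ≡⟨ cong (k +_) (+-identityʳ k) ⟨
    2 * k        ≤⟨ *-monoˡ-≤ k (^-monoʳ-≤ 2 1≤x) ⟩
    2 ^ x * k    ∎

2^a+2^b+suc[k]≤2^T : ∀ {a b k T} → 1 ≤ k → a + suc k ≤ T → b + suc k ≤ T → 2 ^ a + 2 ^ b + suc k ≤ 2 ^ T
2^a+2^b+suc[k]≤2^T {a} {b} {k} {T} 1≤k a+suc[k]≤T b+suc[k]≤T = begin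
  2 ^ a + 2 ^ b + suc k   ≤⟨ +-monoˡ-≤ (suc k) (+-mono-≤ (^-monoʳ-≤ 2 (m+n≤o⇒m≤o∸n a a+suc[k]≤T))
                                                         (^-monoʳ-≤ 2 (m+n≤o⇒m≤o∸n b b+suc[k]≤T))) ⟩
  2 ^ c + 2 ^ c + suc k   ≡⟨ cong (λ e → 2 ^ c + e + suc k) (+-identityʳ (2 ^ c)) ⟨
  2 ^ suc c + suc k       ≤⟨ 2^x+suc[k]≤2^[x+k] (suc c) k (s≤s z≤n) 1≤k ⟩
  2 ^ (suc c + k)         ≡⟨ cong (2 ^_) (trans (sym (+-suc c k)) (m∸n+n≡m (≤-trans (m≤n+m (suc k) a) a+suc[k]≤T))) ⟩
  2 ^ T                   ∎
  where
  open ≤-Reasoning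
  c : ℕ
  c = T ∸ suc k

module _ (k : ℕ) where

  private
    Lg : ℕ
    Lg = logStar (k * k + k)

  typeBits-FO-≤ : ∀ j m → m + j ≤ k → typeBits FO j m 0 ≤ tower (j + Lg)
  typeBits-FO-≤ zero m h = begin
    m + m * m + 0   ≡⟨ +-identityʳ _ ⟩
    m + m * m       ≤⟨ +-mono-≤ m≤k (*-mono-≤ m≤k m≤k) ⟩
    k + k * k       ≡⟨ +-comm k (k * k) ⟩
    k * k + k       ≤⟨ ≤tower-logStar (k * k + k) ⟩
    tower Lg        ∎
    where
    open ≤-Reasoning
    m≤k : m ≤ k
    m≤k = subst (_≤ k) (+-identityʳ m) h
  typeBits-FO-≤ (suc j) m h = begin
    2 ^ typeBits FO j (suc m) 0 + 0   ≡⟨ +-identityʳ _ ⟩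
    2 ^ typeBits FO j (suc m) 0       ≤⟨ ^-monoʳ-≤ 2 (typeBits-FO-≤ j (suc m) (subst (_≤ k) (+-suc m j) h)) ⟩
    2 ^ tower (j + Lg)                ∎
    where open ≤-Reasoning

  typeCount-FO : 2 ^ typeBits FO k 0 0 ≤ twr (k + Lg + 1)
  typeCount-FO = subst (λ e → 2 ^ typeBits FO k 0 0 ≤ tower e) (+-comm 1 (k + Lg))
                   (^-monoʳ-≤ 2 (typeBits-FO-≤ k 0 ≤-refl))

module _ (k : ℕ) where

  private
    Lg : ℕ
    Lg = logStar (suc k * suc k)

  -- The slack suc k absorbs the sum of the two exponentials at the next level.
  typeBits-MSO-≤ : ∀ j m s → m + s + j ≤ k → typeBits MSO j m s + suc k ≤ tower (j + Lg)
  typeBits-MSO-≤ zero m s h = begin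
    m + m * m + s * m + suc k   ≡⟨ cong (_+ suc k) (atomBits m s) ⟩
    m * suc (m + s) + suc k     ≤⟨ +-monoˡ-≤ (suc k) (*-mono-≤ (≤-trans (m≤m+n m s) m+s≤k) (s≤s m+s≤k)) ⟩
    k * suc k + suc k           ≡⟨ +-comm (k * suc k) (suc k) ⟩
    suc k * suc k               ≤⟨ ≤tower-logStar (suc k * suc k) ⟩
    tower Lg                    ∎
    where
    open ≤-Reasoning
    m+s≤k : m + s ≤ k
    m+s≤k = subst (_≤ k) (+-identityʳ (m + s)) h
    atomBits : ∀ m s → m + m * m + s * m ≡ m * suc (m + s)
    atomBits = solve-∀
  typeBits-MSO-≤ (suc j) m s h =
    2^a+2^b+suc[k]≤2^T 1≤k (typeBits-MSO-≤ j (suc m) s (subst (_≤ k) (+-suc (m + s) j) h))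
                           (typeBits-MSO-≤ j m (suc s) (subst (_≤ k) m+s+suc[j]≡m+suc[s]+j h))
    where
    1≤k : 1 ≤ k
    1≤k = ≤-trans (s≤s z≤n) (≤-trans (m≤n+m (suc j) (m + s)) h)
    m+s+suc[j]≡m+suc[s]+j : m + s + suc j ≡ m + suc s + j
    m+s+suc[j]≡m+suc[s]+j = trans (+-suc (m + s) j) (cong (_+ j) (sym (+-suc m s)))

  typeCount-MSO : 2 ^ typeBits MSO k 0 0 ≤ twr (k + Lg + 1)
  typeCount-MSO = subst (λ e → 2 ^ typeBits MSO k 0 0 ≤ tower e) (+-comm 1 (k + Lg))
                    (^-monoʳ-≤ 2 (≤-trans (m≤m+n _ (suc k)) (typeBits-MSO-≤ k 0 0 ≤-refl)))

module Bounds (L : Logic) (k B : ℕ) (typesFit : 2 ^ typeBits L k 0 0 ≤ B) where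

  private
    many : ∀ w → B < len w → 2 ^ typeBits L k 0 0 < len w
    many w = ≤-<-trans typesFit

  dnBound : DNBound L k B
  dnBound w (φ , qφ , defines) with len w ≤? B
  ... | yes w≤B = w≤B
  ... | no  w≰B =
    let v , longer , g = longerEquivalent L k w (many w (≰⇒> w≰B)) 1
        v≡w = proj₁ (defines v) (EF-preserves-Sat φ k qφ g (proj₂ (defines w) refl))
    in contradiction (subst (λ u → 1 + len w ≤ len u) v≡w longer) (n≮n (len w))

  lsBound : LSBound L k B
  lsBound φ qφ w w⊨φ = shrink (len w) w ≤-refl w⊨φ
    where
    shrink : ∀ fuel (w : Word) → len w ≤ fuel → w ⊨ φ → Σ Word λ v → v ⊨ φ × len v ≤ B
    shrink fuel w _ w⊨φ with len w ≤? B
    shrink fuel       w _       w⊨φ | yes w≤B = w , w⊨φ , w≤B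
    shrink zero       w ()      w⊨φ | no  _
    shrink (suc fuel) w w≤fuel w⊨φ | no  w≰B =
      let v , shorter , g = shorterEquivalent L k w (many w (≰⇒> w≰B))
      in shrink fuel v (≤-pred (≤-trans shorter w≤fuel)) (EF-preserves-Sat φ k qφ g w⊨φ)

  hBound : HBound L k B
  hBound φ qφ w w⊨φ w>B t =
    let v , longer , g = longerEquivalent L k w (many w w>B) t
    in v , EF-preserves-Sat φ k qφ g w⊨φ , ≤-trans (m≤m+n t (len w)) longer

corollary3 : (k : ℕ) →
    (DNBound FO k (twr (k + logStar (k * k + k) + 1))
      × LSBound FO k (twr (k + logStar (k * k + k) + 1))
      × HBound FO k (twr (k + logStar (k * k + k) + 1)))
    × (DNBound MSO k (twr (k + logStar (suc k * suc k) + 1))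
      × LSBound MSO k (twr (k + logStar (suc k * suc k) + 1))
      × HBound MSO k (twr (k + logStar (suc k * suc k) + 1)))
corollary3 k = (FO.dnBound , FO.lsBound , FO.hBound) , (MSO.dnBound , MSO.lsBound , MSO.hBound)
  where
  module FO  = Bounds FO  k _ (typeCount-FO k)
  module MSO = Bounds MSO k _ (typeCount-MSO k)
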